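{- For every digraph $G$, $\mathrm{d\text{ - }pw}(G)\le\mathrm{d\text{ - }cutw}(G)$.
   Context: Digraphs $G=(V,E)$ are finite with $E\subseteq\{(u,v):u\ne v\}$. A layout is a bijection $\varphi:V\to\{1,\dots,|V|\}$; $L(i,\varphi)=\{u:\varphi(u)\le i\}$, $R(i,\varphi)=\{u:\varphi(u)>i\}$. $\mathrm{d\text{ - }pw}(G)$ is the minimum of $\max|X_i|-1$ over sequences $(X_1,\dots,X_r)$ of subsets of $V$ with $\bigcup X_i=V$, for each $(u,v)\in E$ some $i\le j$ with $u\in X_i,v\in X_j$, and $X_i\cap X_\ell\subseteq X_j$ for $i<j<\ell$. $\mathrm{d\text{ - }cutw}(G)=\min_\varphi\max_i|\{(u,v)\in E:u\in L(i,\varphi),v\in R(i,\varphi)\}|$. -}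

module Defs where

open import Data.Nat using (ℕ; zero; suc; _+_; _≤_; _<_; _⊔_; _<ᵇ_; _≤ᵇ_)
open import Data.Bool using (Bool; true; false; _∧_; if_then_else_)
open import Data.Fin using (Fin; toℕ)
open import Data.Fin.Subset using (Subset; _∈_; ∣_∣)
open import Data.List using (List; upTo; foldr; map; allFin)
open import Data.Nat.ListAction using (sum)
open import Data.Product using (Σ; ∃; ∃-syntax; _×_; _,_)
open import Function.Bundles using (_↔_; Inverse)
open import Relation.Binary.PropositionalEquality using (_≡_)

record Digraph (n : ℕ) : Set where
  field
    adj    : Fin n → Fin n → Bool
    noLoop : ∀ u → adj u u ≡ false
open Digraph public

-- A layout is a bijection V → {1,…,n}; we use positions Fin n = {0,…,n-1},
-- so vertex u has position toℕ (φ u) + 1 in the paper's convention.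
Layout : ℕ → Set
Layout n = Fin n ↔ Fin n

pos : ∀ {n} → Layout n → Fin n → ℕ
pos φ u = suc (toℕ (Inverse.to φ u))

-- number of edges (u,v) with u ∈ L(i,φ) (pos u ≤ i) and v ∈ R(i,φ) (pos v > i)
cutSize : ∀ {n} → Digraph n → Layout n → ℕ → ℕ
cutSize {n} G φ i =
  sum (map (λ u → sum (map (λ v →
        if adj G u v ∧ (pos φ u ≤ᵇ i) ∧ (i <ᵇ pos φ v) then 1 else 0)
      (allFin n))) (allFin n))

-- width of a layout: max over i ∈ {0,…,n} of the cut size
-- (the cuts at i = 0 and i = n are empty, so this equals the max over 1 ≤ i ≤ n)
layoutCutWidth : ∀ {n} → Digraph n → Layout n → ℕ
layoutCutWidth {n} G φ = foldr _⊔_ 0 (map (cutSize G φ) (upTo (suc n)))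

CutWidthAtMost : ∀ {n} → Digraph n → ℕ → Set
CutWidthAtMost {n} G k = Σ (Layout n) λ φ → layoutCutWidth G φ ≤ k

record DirPathDecomposition {n : ℕ} (G : Digraph n) : Set where
  field
    r      : ℕ
    bag    : Fin r → Subset n
    cover  : ∀ (v : Fin n) → ∃[ i ] (v ∈ bag i)
    edge   : ∀ (u v : Fin n) → adj G u v ≡ true →
               ∃[ i ] ∃[ j ] (toℕ i ≤ toℕ j × u ∈ bag i × v ∈ bag j)
    interp : ∀ (i j l : Fin r) → toℕ i < toℕ j → toℕ j < toℕ l →
               ∀ (v : Fin n) → v ∈ bag i → v ∈ bag l → v ∈ bag j
open DirPathDecomposition public

-- width ≤ k  means  max |X_i| - 1 ≤ k, i.e. every bag has at most k+1 vertices
WidthAtMost : ∀ {n} {G : Digraph n} → DirPathDecomposition G → ℕ → Set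
WidthAtMost D k = ∀ i → ∣ bag D i ∣ ≤ suc k

PathWidthAtMost : ∀ {n} → Digraph n → ℕ → Set
PathWidthAtMost G k = Σ (DirPathDecomposition G) λ D → WidthAtMost D k

module Submission where

-- Fix a layout φ of width ≤ k and write q(w) ∈ {0,…,n-1} for the position of
-- w.  An edge (u,w) crosses position p when q(u) ≤ p < q(w); the crossing
-- edges at p are exactly those counted by the cut at i = p+1.  The bag at
-- position p is
--     X_p = {φ⁻¹(p)} ∪ {w : some edge (u,w) crosses p},
-- so |X_p| ≤ 1 + cut(p+1) ≤ 1 + k.  The bags are listed in DECREASING order
-- of position.  Then an edge (u,v) with q(v) ≤ q(u) is covered by
-- X_{q(u)}, X_{q(v)} (in this order), and one with q(u) < q(v) lies inside
-- X_{q(u)}.  Interpolation holds because {p : w ∈ X_p} is an interval ending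
-- at q(w): membership forces p ≤ q(w), and a crossing edge at p also crosses
-- every p' with p ≤ p' < q(w).

open import Defs
open import Data.Nat using (ℕ; zero; suc; _+_; _≤_; _<_; _⊔_; _≤ᵇ_; _<ᵇ_; z≤n; s≤s; s≤s⁻¹)
open import Data.Nat.Properties
open import Data.Bool using (Bool; true; false; _∧_; if_then_else_; T)
open import Data.Bool.Properties using (T-∧; T-≡)
open import Data.Fin as Fin using (Fin; toℕ; opposite)
open import Data.Fin.Properties using (any?; opposite-prop; opposite-involutive; toℕ<n)
open import Data.Fin.Subset using (Subset; _∈_; _∪_; ⁅_⁆; ∣_∣)
open import Data.Fin.Subset.Properties using (∣⁅x⁆∣≡1; x∈⁅x⁆; x∈⁅y⁆⇒x≡y; x∈p∪q⁺; x∈p∪q⁻)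
open import Data.Vec as Vec using ([]; _∷_)
open import Data.Vec.Properties using (lookup∘tabulate; lookup⇒[]=; []=⇒lookup)
open import Data.List using (List; foldr; map; allFin; tabulate)
open import Data.List.Properties using (map-tabulate)
open import Data.List.Membership.Propositional as ListMembership using ()
open import Data.List.Membership.Propositional.Properties using (∈-map⁺; ∈-upTo⁺)
open import Data.List.Relation.Unary.Any using (here; there)
open import Data.Nat.ListAction as ListSum using ()
open import Algebra.Properties.CommutativeMonoid.Sum +-0-commutativeMonoid using (sum-syntax; sum-cong-≗; ∑-comm)
open import Data.Product using (∃-syntax; _×_; _,_)
open import Data.Sum using (_⊎_; inj₁; inj₂)
open import Data.Empty using (⊥-elim)
open import Function.Bundles using (Inverse; Equivalence)
open import Relation.Nullary using (Dec; yes; no; does; T?)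
open import Relation.Nullary.Decidable using (dec-true)
open import Function using (_∘_; id)
open import Relation.Binary.PropositionalEquality

ind : Bool → ℕ
ind b = if b then 1 else 0

ind-true : ∀ {b} → b ≡ true → ind b ≡ 1
ind-true refl = refl

does-true⇒ : ∀ {a} {A : Set a} (a? : Dec A) → does a? ≡ true → A
does-true⇒ (yes a) _ = a

sum-tabulate : ∀ {n} (h : Fin n → ℕ) → ListSum.sum (tabulate h) ≡ ∑[ i < n ] h i
sum-tabulate {zero}  h = refl
sum-tabulate {suc n} h = cong (h Fin.zero +_) (sum-tabulate (h ∘ Fin.suc))

sum-allFin : ∀ {n} (h : Fin n → ℕ) → ListSum.sum (map h (allFin n)) ≡ ∑[ i < n ] h i
sum-allFin h = trans (cong ListSum.sum (map-tabulate id h)) (sum-tabulate h)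

∑-mono-≤ : ∀ {n} {f g : Fin n → ℕ} → (∀ i → f i ≤ g i) → ∑[ i < n ] f i ≤ ∑[ i < n ] g i
∑-mono-≤ {zero}  _   = z≤n
∑-mono-≤ {suc n} f≤g = +-mono-≤ (f≤g Fin.zero) (∑-mono-≤ (f≤g ∘ Fin.suc))

∑-term : ∀ {n} (f : Fin n → ℕ) (i : Fin n) → f i ≤ ∑[ j < n ] f j
∑-term f Fin.zero    = m≤m+n _ _
∑-term f (Fin.suc i) = ≤-trans (∑-term (f ∘ Fin.suc) i) (m≤n+m _ _)

-- The indicator of "∃ u. P u" is bounded by the number of witnesses u;
-- this turns a count of heads into a count of edges.
ind-any≤∑ : ∀ {n} (P : Fin n → Bool) → ind (does (any? (T? ∘ P))) ≤ ∑[ u < n ] ind (P u)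
ind-any≤∑ P with any? (T? ∘ P)
... | yes (u , Pu) = ≤-trans (≤-reflexive (sym (ind-true (Equivalence.to T-≡ Pu)))) (∑-term (ind ∘ P) u)
... | no _         = z≤n

∈⇒≤max : ∀ {x} {xs : List ℕ} → x ListMembership.∈ xs → x ≤ foldr _⊔_ 0 xs
∈⇒≤max (here refl)  = m≤m⊔n _ _
∈⇒≤max (there x∈xs) = ≤-trans (∈⇒≤max x∈xs) (m≤n⊔m _ _)

∣p∪q∣≤∣p∣+∣q∣ : ∀ {n} (p q : Subset n) → ∣ p ∪ q ∣ ≤ ∣ p ∣ + ∣ q ∣
∣p∪q∣≤∣p∣+∣q∣ []          []          = z≤n
∣p∪q∣≤∣p∣+∣q∣ (true ∷ p)  (true ∷ q)  =
  s≤s (≤-trans (∣p∪q∣≤∣p∣+∣q∣ p q) (+-monoʳ-≤ ∣ p ∣ (n≤1+n ∣ q ∣)))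
∣p∪q∣≤∣p∣+∣q∣ (true ∷ p)  (false ∷ q) = s≤s (∣p∪q∣≤∣p∣+∣q∣ p q)
∣p∪q∣≤∣p∣+∣q∣ (false ∷ p) (true ∷ q)  =
  ≤-trans (s≤s (∣p∪q∣≤∣p∣+∣q∣ p q)) (≤-reflexive (sym (+-suc ∣ p ∣ ∣ q ∣)))
∣p∪q∣≤∣p∣+∣q∣ (false ∷ p) (false ∷ q) = ∣p∪q∣≤∣p∣+∣q∣ p q

∈-tabulate⁺ : ∀ {n} (P : Fin n → Bool) {w} → P w ≡ true → w ∈ Vec.tabulate P
∈-tabulate⁺ P {w} Pw = lookup⇒[]= w (Vec.tabulate P) (trans (lookup∘tabulate P w) Pw)

∈-tabulate⁻ : ∀ {n} (P : Fin n → Bool) {w} → w ∈ Vec.tabulate P → P w ≡ true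
∈-tabulate⁻ P {w} w∈P = trans (sym (lookup∘tabulate P w)) ([]=⇒lookup w∈P)

∣tabulate∣ : ∀ {n} (P : Fin n → Bool) → ∣ Vec.tabulate P ∣ ≡ ∑[ w < n ] ind (P w)
∣tabulate∣ {zero}  P = refl
∣tabulate∣ {suc n} P with P Fin.zero
... | true  = cong suc (∣tabulate∣ (P ∘ Fin.suc))
... | false = ∣tabulate∣ (P ∘ Fin.suc)

opposite-≤ : ∀ {n} {i j : Fin n} → toℕ i ≤ toℕ j → toℕ (opposite j) ≤ toℕ (opposite i)
opposite-≤ {n} {i} {j} i≤j rewrite opposite-prop i | opposite-prop j = ∸-monoʳ-≤ n (s≤s i≤j)

opposite-< : ∀ {n} {i j : Fin n} → toℕ i < toℕ j → toℕ (opposite j) < toℕ (opposite i)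
opposite-< {n} {i} {j} i<j rewrite opposite-prop i | opposite-prop j = ∸-monoʳ-< (s≤s i<j) (toℕ<n j)

module LayoutBags {n : ℕ} (G : Digraph n) (φ : Layout n) where
  open Inverse φ using (to; from; strictlyInverseˡ; strictlyInverseʳ)

  -- Position of w in {0,…,n-1}; the paper's position is pos φ w = suc (position w).
  position : Fin n → ℕ
  position w = toℕ (to w)

  -- The edge (u,w) crosses position p: the summand of cutSize G φ (suc p).
  crosses : ℕ → Fin n → Fin n → Bool
  crosses p u w = adj G u w ∧ (pos φ u ≤ᵇ suc p) ∧ (suc p <ᵇ pos φ w)

  Crosses : ℕ → Fin n → Fin n → Set
  Crosses p u w = adj G u w ≡ true × position u ≤ p × p < position w

  crosses⇒Crosses : ∀ {p u w} → T (crosses p u w) → Crosses p u w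
  crosses⇒Crosses {p} {u} {w} c
    with Equivalence.to (T-∧ {adj G u w}) c
  ... | a , l∧r with Equivalence.to (T-∧ {pos φ u ≤ᵇ suc p}) l∧r
  ... | l , r = Equivalence.to T-≡ a , s≤s⁻¹ (≤ᵇ⇒≤ _ _ l) , s≤s⁻¹ (<ᵇ⇒< _ _ r)

  Crosses⇒crosses : ∀ {p u w} → Crosses p u w → T (crosses p u w)
  Crosses⇒crosses {p} {u} {w} (a , u≤p , p<w) =
    Equivalence.from (T-∧ {adj G u w})
      ( Equivalence.from T-≡ a
      , Equivalence.from (T-∧ {pos φ u ≤ᵇ suc p}) (≤⇒≤ᵇ (s≤s u≤p) , <⇒<ᵇ (s≤s p<w)))

  cut-as-∑ : ∀ p → cutSize G φ (suc p) ≡ ∑[ u < n ] ∑[ w < n ] ind (crosses p u w)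
  cut-as-∑ p = trans (sum-allFin (λ u → ListSum.sum (map (ind ∘ crosses p u) (allFin n))))
                     (sum-cong-≗ (λ u → sum-allFin (ind ∘ crosses p u)))

  heads : ℕ → Subset n
  heads p = Vec.tabulate (λ w → does (any? (λ u → T? (crosses p u w))))

  heads-size : ∀ p → ∣ heads p ∣ ≤ cutSize G φ (suc p)
  heads-size p = begin
    ∣ heads p ∣                                     ≡⟨ ∣tabulate∣ (λ w → does (any? (λ u → T? (crosses p u w)))) ⟩
    ∑[ w < n ] ind (does (any? (λ u → T? (crosses p u w))))
                                                    ≤⟨ ∑-mono-≤ (λ w → ind-any≤∑ (λ u → crosses p u w)) ⟩
    ∑[ w < n ] ∑[ u < n ] ind (crosses p u w)       ≡⟨ ∑-comm (λ u w → ind (crosses p u w)) ⟨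
    ∑[ u < n ] ∑[ w < n ] ind (crosses p u w)       ≡⟨ cut-as-∑ p ⟨
    cutSize G φ (suc p)                             ∎
    where open ≤-Reasoning

  heads⁺ : ∀ {p u w} → Crosses p u w → w ∈ heads p
  heads⁺ {p} {u} {w} c = ∈-tabulate⁺ _ (dec-true (any? (λ v → T? (crosses p v w))) (u , Crosses⇒crosses c))

  heads⁻ : ∀ {p w} → w ∈ heads p → ∃[ u ] Crosses p u w
  heads⁻ {p} {w} w∈ with does-true⇒ (any? (λ u → T? (crosses p u w))) (∈-tabulate⁻ _ w∈)
  ... | u , c = u , crosses⇒Crosses c

  bagAt : Fin n → Subset n
  bagAt c = ⁅ from c ⁆ ∪ heads (toℕ c)

  bagAt-size : ∀ c → ∣ bagAt c ∣ ≤ suc (cutSize G φ (suc (toℕ c)))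
  bagAt-size c = begin
    ∣ bagAt c ∣                                  ≤⟨ ∣p∪q∣≤∣p∣+∣q∣ ⁅ from c ⁆ (heads (toℕ c)) ⟩
    ∣ ⁅ from c ⁆ ∣ + ∣ heads (toℕ c) ∣           ≡⟨ cong (_+ ∣ heads (toℕ c) ∣) (∣⁅x⁆∣≡1 (from c)) ⟩
    suc ∣ heads (toℕ c) ∣                        ≤⟨ s≤s (heads-size (toℕ c)) ⟩
    suc (cutSize G φ (suc (toℕ c)))              ∎
    where open ≤-Reasoning

  bagAt-own : ∀ w → w ∈ bagAt (to w)
  bagAt-own w = x∈p∪q⁺ (inj₁ (subst (λ v → w ∈ ⁅ v ⁆) (sym (strictlyInverseʳ w)) (x∈⁅x⁆ w)))

  bagAt-head : ∀ {c u w} → Crosses (toℕ c) u w → w ∈ bagAt c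
  bagAt-head c = x∈p∪q⁺ (inj₂ (heads⁺ c))

  bagAt⁻ : ∀ {c w} → w ∈ bagAt c → position w ≡ toℕ c ⊎ ∃[ u ] Crosses (toℕ c) u w
  bagAt⁻ {c} {w} w∈ with x∈p∪q⁻ ⁅ from c ⁆ (heads (toℕ c)) w∈
  ... | inj₁ w∈⁅c⁆ = inj₁ (cong toℕ (trans (cong to (x∈⁅y⁆⇒x≡y (from c) w∈⁅c⁆)) (strictlyInverseˡ c)))
  ... | inj₂ w∈h   = inj₂ (heads⁻ w∈h)

  bagAt-below : ∀ {c w} → w ∈ bagAt c → toℕ c ≤ position w
  bagAt-below w∈ with bagAt⁻ w∈
  ... | inj₁ w≡c             = ≤-reflexive (sym w≡c)
  ... | inj₂ (_ , _ , _ , c<w) = <⇒≤ c<w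

  bagAt-interval : ∀ {a b w} → w ∈ bagAt a → toℕ a ≤ toℕ b → toℕ b < position w → w ∈ bagAt b
  bagAt-interval w∈a a≤b b<w with bagAt⁻ w∈a
  ... | inj₁ w≡a                  = ⊥-elim (<⇒≢ (≤-<-trans a≤b b<w) (sym w≡a))
  ... | inj₂ (u , e , u≤a , a<w) = bagAt-head (e , ≤-trans u≤a a≤b , b<w)

  slot : Fin n → Fin n
  slot w = opposite (to w)

  ∈-reversed : ∀ {c w} → w ∈ bagAt c → w ∈ bagAt (opposite (opposite c))
  ∈-reversed {c} {w} = subst (λ d → w ∈ bagAt d) (sym (opposite-involutive c))

  covers-edge : ∀ u v → adj G u v ≡ true →
                ∃[ i ] ∃[ j ] (toℕ i ≤ toℕ j × u ∈ bagAt (opposite i) × v ∈ bagAt (opposite j))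
  covers-edge u v e with position v ≤? position u
  ... | yes v≤u = slot u , slot v , opposite-≤ v≤u , ∈-reversed (bagAt-own u) , ∈-reversed (bagAt-own v)
  ... | no  v≰u = slot u , slot u , ≤-refl , ∈-reversed (bagAt-own u)
                , ∈-reversed (bagAt-head (e , ≤-refl , ≰⇒> v≰u))

  -- Interpolation, read through the reversal: indices i < j < l are
  -- positions opp l < opp j < opp i, and bagAt-interval applies.
  interpolates : ∀ (i j l : Fin n) → toℕ i < toℕ j → toℕ j < toℕ l →
                 ∀ v → v ∈ bagAt (opposite i) → v ∈ bagAt (opposite l) → v ∈ bagAt (opposite j)
  interpolates i j l i<j j<l v v∈i v∈l =
    bagAt-interval v∈l (<⇒≤ (opposite-< j<l)) (<-≤-trans (opposite-< i<j) (bagAt-below v∈i))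

  decomposition : DirPathDecomposition G
  decomposition = record
    { r      = n
    ; bag    = bagAt ∘ opposite
    ; cover  = λ v → slot v , ∈-reversed (bagAt-own v)
    ; edge   = covers-edge
    ; interp = interpolates
    }

  decomposition-size : ∀ b → ∣ bag decomposition b ∣ ≤ suc (layoutCutWidth G φ)
  decomposition-size b = ≤-trans (bagAt-size (opposite b)) (s≤s cut≤width)
    where
    cut≤width : cutSize G φ (suc (toℕ (opposite b))) ≤ layoutCutWidth G φ
    cut≤width = ∈⇒≤max (∈-map⁺ (cutSize G φ) (∈-upTo⁺ (s≤s (toℕ<n (opposite b)))))

lemma5p10 : ∀ (n : ℕ) (G : Digraph n) (k : ℕ) →
              CutWidthAtMost G k → PathWidthAtMost G k
lemma5p10 n G k (φ , width≤k) =
  decomposition , λ b → ≤-trans (decomposition-size b) (s≤s width≤k)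
  where open LayoutBags G φ
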